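{- For every formula $\psi=\exists y_1\dots y_k\,\psi_0(y_0,y_1,\dots,y_k)$ of $\mathrm{F}_1[\mathrm{succ},<]$ with the single free variable $y_0$, there exists an $\mathrm{FO}^2[\mathrm{succ},<]$ formula $\psi'$ with one free variable such that for every word or $\omega$-word $\mathfrak M$ and every $a\in M$, $\mathfrak M\models\psi[a]$ iff $\mathfrak M\models\psi'[a]$.
   Context: A word is a finite structure over a signature $\sigma_0\cup\{\mathrm{succ},<\}$, where $\sigma_0$ is a finite set of unary relation symbols, $<$ is a strict linear order and $\mathrm{succ}$ its induced successor relation; an $\omega$-word is an infinite such structure whose $\{\mathrm{succ},<\}$-reduct is isomorphic to $(\mathbb N,+1,<)$. $\mathrm{F}_1[\mathrm{succ},<]$ (the one-dimensional fragment) is the smallest set of first-order formulas over $\sigma_0\cup\{\mathrm{succ},<\}$ containing all atoms and equalities, closed under $\vee,\neg$, and such that if $\varphi$ has free variables among $x_0,\dots,x_k$ then $\exists x_0\dots x_k\varphi$ and $\exists x_1\dots x_k\varphi$ belong to it. $\mathrm{FO}^2[\mathrm{succ},<]$ is the set of first-order formulas over the same signature using only two variables. -}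

module Defs where

open import Data.Nat using (ℕ; zero; suc; _<_; _≟_)
open import Data.Fin using (Fin)
open import Data.Bool using (Bool; T)
open import Data.Maybe using (Maybe; just; nothing)
open import Data.List using (List; []; _∷_; foldr)
open import Data.List.Membership.Propositional using (_∈_)
open import Data.List.Relation.Unary.Unique.Propositional using (Unique)
open import Data.Product using (_×_; Σ)
open import Data.Unit using (⊤)
open import Data.Sum using (_⊎_)
open import Data.Empty using (⊥)
open import Relation.Nullary using (¬_; yes; no)
open import Relation.Binary.PropositionalEquality using (_≡_; _≢_)

data Formula (s : ℕ) : Set where
  rel   : Fin s → ℕ → Formula s
  succ  : ℕ → ℕ → Formula s                -- succ(x , y)  i.e. y = x + 1
  lt    : ℕ → ℕ → Formula s
  eq    : ℕ → ℕ → Formula s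
  or    : Formula s → Formula s → Formula s
  neg   : Formula s → Formula s
  ex    : ℕ → Formula s → Formula s

exs : ∀ {s} → List ℕ → Formula s → Formula s
exs xs φ = foldr ex φ xs

Free : ∀ {s} → ℕ → Formula s → Set
Free z (rel P x) = z ≡ x
Free z (succ x y) = (z ≡ x) ⊎ (z ≡ y)
Free z (lt x y) = (z ≡ x) ⊎ (z ≡ y)
Free z (eq x y) = (z ≡ x) ⊎ (z ≡ y)
Free z (or φ ψ) = Free z φ ⊎ Free z ψ
Free z (neg φ) = Free z φ
Free z (ex x φ) = (z ≢ x) × Free z φ

data F1 {s : ℕ} : Formula s → Set where
  f-rel  : ∀ P x → F1 (rel P x)
  f-succ : ∀ x y → F1 (succ x y)
  f-lt   : ∀ x y → F1 (lt x y)
  f-eq   : ∀ x y → F1 (eq x y)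
  f-or   : ∀ {φ ψ} → F1 φ → F1 ψ → F1 (or φ ψ)
  f-neg  : ∀ {φ} → F1 φ → F1 (neg φ)
  f-exAll : ∀ {φ} (x₀ : ℕ) (xs : List ℕ) → Unique (x₀ ∷ xs) → F1 φ →
            (∀ z → Free z φ → z ∈ (x₀ ∷ xs)) → F1 (exs (x₀ ∷ xs) φ)
  f-exButOne : ∀ {φ} (x₀ : ℕ) (xs : List ℕ) → Unique (x₀ ∷ xs) → F1 φ →
            (∀ z → Free z φ → z ∈ (x₀ ∷ xs)) → F1 (exs xs φ)

FO2 : ∀ {s} → Formula s → Set
FO2 (rel P x) = x < 2
FO2 (succ x y) = x < 2 × y < 2
FO2 (lt x y) = x < 2 × y < 2
FO2 (eq x y) = x < 2 × y < 2
FO2 (or φ ψ) = FO2 φ × FO2 ψ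
FO2 (neg φ) = FO2 φ
FO2 (ex x φ) = x < 2 × FO2 φ

-- Positions are natural numbers with the usual succ and <.
-- len = just n : finite word with domain {0,…,n-1};
-- len = nothing : ω-word with domain ℕ.
-- lab i P : whether position i satisfies P (values outside the domain
-- are irrelevant since variables only range over the domain).

record Model (s : ℕ) : Set where
  field
    len : Maybe ℕ
    lab : ℕ → Fin s → Bool

InDom : ∀ {s} → Model s → ℕ → Set
InDom M i with Model.len M
... | just n  = i < n
... | nothing = ⊤

_[_↦_] : (ℕ → ℕ) → ℕ → ℕ → (ℕ → ℕ)
(ρ [ x ↦ a ]) z with z ≟ x
... | yes _ = a
... | no  _ = ρ z

-- Classical (Tarskian) satisfaction, rendered via the negative
-- (Gödel–Gentzen) translation so that classical reasoning is valid:
-- ∨ is ¬(¬A ∧ ¬B) and ∃ is ¬∀¬.  Atoms are decidable.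
Sat : ∀ {s} → Model s → (ℕ → ℕ) → Formula s → Set
Sat M ρ (rel P x) = T (Model.lab M (ρ x) P)
Sat M ρ (succ x y) = suc (ρ x) ≡ ρ y
Sat M ρ (lt x y) = ρ x < ρ y
Sat M ρ (eq x y) = ρ x ≡ ρ y
Sat M ρ (or φ ψ) = ¬ (¬ Sat M ρ φ × ¬ Sat M ρ ψ)
Sat M ρ (neg φ) = ¬ Sat M ρ φ
Sat M ρ (ex x φ) = ¬ (∀ i → InDom M i → ¬ Sat M (ρ [ x ↦ i ]) φ)

module Submission where

-- An F₁ formula is, by induction on its structure, equivalent to a Boolean combination of atoms
-- x < y, succ(x, y), x = y and of FO² formulas with one free variable evaluated at variables; the
-- only real step is ∃x̄ β(x₀, x̄) for such a combination β.  Whether β holds depends only on the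
-- ⟨<, succ⟩-type of the tuple and on the truth values of its unary parts.  Shrinking every gap
-- between the positions of the tuple to length two turns its type into positions below 2|x₀x̄|, so
-- there are finitely many candidate types and truth assignments.  For each candidate satisfying β,
-- an FO² formula walks from x₀ to the left and to the right through the candidate positions,
-- reusing the two variables at each step, demanding "successor" or "further than successor" between
-- consecutive positions and the chosen truth values at each of them.  The disjunction of these
-- walks is equivalent to ∃x̄ β.

open import Defs
open import Data.Nat using (ℕ; zero; suc; _+_; _≤_; _<_; z≤n; s≤s; _≟_; _<?_)
import Data.Nat.Properties as ℕ
open import Data.Bool using (Bool; true; false; T; T?; _∨_; not; if_then_else_)
open import Data.Fin using (Fin; zero; suc; splitAt; _↑ˡ_; _↑ʳ_)
import Data.Fin.Properties as Fin
open import Data.List using (List; []; _∷_; map; filter; upTo; downFrom; length)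
open import Data.List.Membership.Propositional using (_∈_; _∉_; find; lose)
open import Data.List.Membership.DecPropositional _≟_ using (_∈?_)
open import Data.List.Relation.Unary.Any as Any using (Any; here; there; any?)
import Data.List.Relation.Unary.Any.Properties as Anyₚ
import Data.List.Relation.Unary.All as ListAll
open import Data.List.Relation.Unary.Linked using (Linked; []; [-]; _∷_)
open import Data.List.Relation.Unary.AllPairs using (_∷_)
open import Data.List.Relation.Unary.Linked.Properties using (Linked⇒All; filter⁺; applyUpTo⁺₂; applyDownFrom⁺₂)
open import Data.List.Membership.Propositional.Properties using (∈-filter⁺; ∈-filter⁻; ∈-upTo⁺; ∈-upTo⁻; ∈-downFrom⁺; ∈-downFrom⁻)
open import Data.Vec using (Vec; []; _∷_; lookup)
import Data.Vec as Vec
open import Data.Vec.Relation.Unary.All using (All; []; _∷_)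
open import Data.Product using (Σ; _×_; _,_; proj₁; proj₂)
open import Data.Sum using (_⊎_; inj₁; inj₂; [_,_]′; swap)
open import Data.Empty using (⊥-elim)
open import Data.Unit using (tt)
open import Effect.Monad using (RawMonad)
open import Function using (_∘_; id; _⇔_; mk⇔; Equivalence)
open import Function.Properties.Equivalence using () renaming (sym to ⇔-sym; trans to ⇔-trans)
open import Algebra.Properties.CommutativeSemigroup ℕ.+-commutativeSemigroup using (interchange)
open import Level using (0ℓ)
open import Relation.Nullary using (¬_; Dec; yes; no)
open import Relation.Nullary.Decidable using (decidable-stable; ¬¬-excluded-middle; _×-dec_; isYes; True; toWitness; fromWitness)
open import Relation.Nullary.Negation using (Stable; negated-stable; ¬¬-Monad)
open import Relation.Binary.PropositionalEquality
open import Relation.Binary.Definitions using (tri<; tri≈; tri>)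

open Equivalence using (to; from)
-- Sat is the Gödel–Gentzen translation, hence stable; classical steps run in the ¬¬ monad.
open RawMonad {f = 0ℓ} ¬¬-Monad using (return; _>>=_; _<$>_)

upd-same : ∀ (ρ : ℕ → ℕ) x a → (ρ [ x ↦ a ]) x ≡ a
upd-same ρ x a with x ≟ x
... | yes _ = refl
... | no x≢x = ⊥-elim (x≢x refl)

upd-other : ∀ (ρ : ℕ → ℕ) {x} a {z} → z ≢ x → (ρ [ x ↦ a ]) z ≡ ρ z
upd-other ρ {x} a {z} z≢x with z ≟ x
... | yes z≡x = ⊥-elim (z≢x z≡x)
... | no _ = refl

module _ {s : ℕ} (M : Model s) where

  Sat-stable : ∀ ρ (φ : Formula s) → Stable (Sat M ρ φ)
  Sat-stable ρ (rel P x) = decidable-stable (T? _)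
  Sat-stable ρ (succ x y) = decidable-stable (suc (ρ x) ≟ ρ y)
  Sat-stable ρ (lt x y) = decidable-stable (ρ x <? ρ y)
  Sat-stable ρ (eq x y) = decidable-stable (ρ x ≟ ρ y)
  Sat-stable ρ (or φ ψ) = negated-stable
  Sat-stable ρ (neg φ) = negated-stable
  Sat-stable ρ (ex x φ) = negated-stable

  Sat-coincidence : ∀ (φ : Formula s) {ρ ρ′} → (∀ z → Free z φ → ρ z ≡ ρ′ z) → Sat M ρ φ → Sat M ρ′ φ
  Sat-coincidence (rel P x) ρ≗ρ′ = subst (λ v → T (Model.lab M v P)) (ρ≗ρ′ x refl)
  Sat-coincidence (succ x y) ρ≗ρ′ = subst₂ (λ v w → suc v ≡ w) (ρ≗ρ′ x (inj₁ refl)) (ρ≗ρ′ y (inj₂ refl))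
  Sat-coincidence (lt x y) ρ≗ρ′ = subst₂ _<_ (ρ≗ρ′ x (inj₁ refl)) (ρ≗ρ′ y (inj₂ refl))
  Sat-coincidence (eq x y) ρ≗ρ′ = subst₂ _≡_ (ρ≗ρ′ x (inj₁ refl)) (ρ≗ρ′ y (inj₂ refl))
  Sat-coincidence (or φ ψ) ρ≗ρ′ h (¬φ , ¬ψ) =
    h ((¬φ ∘ Sat-coincidence φ (λ z → ρ≗ρ′ z ∘ inj₁)) , (¬ψ ∘ Sat-coincidence ψ (λ z → ρ≗ρ′ z ∘ inj₂)))
  Sat-coincidence (neg φ) ρ≗ρ′ h = h ∘ Sat-coincidence φ (λ z → sym ∘ ρ≗ρ′ z)
  Sat-coincidence (ex x φ) {ρ} {ρ′} ρ≗ρ′ h ¬∃ = h (λ i i∈M → ¬∃ i i∈M ∘ Sat-coincidence φ (agree i))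
    where
    agree : ∀ i z → Free z φ → (ρ [ x ↦ i ]) z ≡ (ρ′ [ x ↦ i ]) z
    agree i z z∈φ with z ≟ x
    ... | yes _ = refl
    ... | no z≢x = ρ≗ρ′ z (z≢x , z∈φ)

Admissible : ∀ {s} → Model s → (ℕ → ℕ) → Set
Admissible M ρ = ∀ z → InDom M (ρ z)

admissible-upd : ∀ {s} (M : Model s) {ρ} x {i} → Admissible M ρ → InDom M i → Admissible M (ρ [ x ↦ i ])
admissible-upd M x ρ∈M i∈M z with z ≟ x
... | yes _ = i∈M
... | no _ = ρ∈M z

module _ {s : ℕ} where

  and : Formula s → Formula s → Formula s
  and φ ψ = neg (or (neg φ) (neg ψ))

  module _ (M : Model s) {ρ : ℕ → ℕ} where

    and-sat : ∀ φ ψ → Sat M ρ (and φ ψ) ⇔ (Sat M ρ φ × Sat M ρ ψ)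
    and-sat φ ψ = mk⇔
      (λ h → Sat-stable M ρ φ (λ ¬φ → h (λ k → proj₁ k ¬φ)) , Sat-stable M ρ ψ (λ ¬ψ → h (λ k → proj₂ k ¬ψ)))
      (λ (φ✓ , ψ✓) k → k ((λ ¬φ → ¬φ φ✓) , (λ ¬ψ → ¬ψ ψ✓)))

    or-sat : ∀ φ ψ → Sat M ρ (or φ ψ) ⇔ (¬ ¬ (Sat M ρ φ ⊎ Sat M ρ ψ))
    or-sat φ ψ = mk⇔ (λ h k → h ((k ∘ inj₁) , (k ∘ inj₂)))
                 (λ h (¬φ , ¬ψ) → h (λ { (inj₁ φ✓) → ¬φ φ✓ ; (inj₂ ψ✓) → ¬ψ ψ✓ }))

    ex-sat : ∀ x φ → Sat M ρ (ex x φ) ⇔ (¬ ¬ Σ ℕ λ i → InDom M i × Sat M (ρ [ x ↦ i ]) φ)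
    ex-sat x φ = mk⇔ (λ h k → h (λ i i∈M φ✓ → k (i , i∈M , φ✓)))
                 (λ h ¬∃ → h (λ (i , i∈M , φ✓) → ¬∃ i i∈M φ✓))

record FO2Formula (s : ℕ) (V : ℕ → Set) : Set where
  constructor fo2
  field
    formula : Formula s
    isFO2   : FO2 formula
    free⊆   : ∀ z → Free z formula → V z

open FO2Formula

Unary : ℕ → Set
Unary s = FO2Formula s (_≡ 0)

Binary : ℕ → Set
Binary s = FO2Formula s (λ z → z ≡ 0 ⊎ z ≡ 1)

⟨_,_⟩ : ℕ → ℕ → ℕ → ℕ
⟨ p , q ⟩ zero = p
⟨ p , q ⟩ (suc _) = q

_⊨_at_ : ∀ {s} → Model s → Unary s → ℕ → Set
M ⊨ χ at p = Sat M (λ _ → p) (formula χ)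

_⊨_at⟨_,_⟩ : ∀ {s} → Model s → Binary s → ℕ → ℕ → Set
M ⊨ R at⟨ p , q ⟩ = Sat M ⟨ p , q ⟩ (formula R)

module _ {s : ℕ} where

  unary-sat : ∀ (M : Model s) ρ (χ : Unary s) → Sat M ρ (formula χ) ⇔ M ⊨ χ at ρ 0
  unary-sat M ρ χ = mk⇔ (Sat-coincidence M (formula χ) (λ z z∈χ → cong ρ (free⊆ χ z z∈χ)))
                        (Sat-coincidence M (formula χ) (λ z z∈χ → cong ρ (sym (free⊆ χ z z∈χ))))

  binary-sat : ∀ (M : Model s) ρ (R : Binary s) → Sat M ρ (formula R) ⇔ M ⊨ R at⟨ ρ 0 , ρ 1 ⟩
  binary-sat M ρ R = mk⇔ (Sat-coincidence M (formula R) agree)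
                         (Sat-coincidence M (formula R) (λ z → sym ∘ agree z))
    where
    agree : ∀ z → Free z (formula R) → ρ z ≡ ⟨ ρ 0 , ρ 1 ⟩ z
    agree z z∈R with free⊆ R z z∈R
    ... | inj₁ refl = refl
    ... | inj₂ refl = refl

  ⊤₁ : Unary s
  ⊤₁ = fo2 (eq 0 0) (s≤s z≤n , s≤s z≤n) (λ { z (inj₁ e) → e ; z (inj₂ e) → e })

  ⊥₁ : Unary s
  ⊥₁ = fo2 (neg (eq 0 0)) (s≤s z≤n , s≤s z≤n) (λ { z (inj₁ e) → e ; z (inj₂ e) → e })

  ¬₁_ : Unary s → Unary s
  ¬₁ χ = fo2 (neg (formula χ)) (isFO2 χ) (free⊆ χ)

  module _ {V : ℕ → Set} where

    _∨ᶠ_ : FO2Formula s V → FO2Formula s V → FO2Formula s V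
    φ ∨ᶠ ψ = fo2 (or (formula φ) (formula ψ)) (isFO2 φ , isFO2 ψ)
                 (λ { z (inj₁ z∈φ) → free⊆ φ z z∈φ ; z (inj₂ z∈ψ) → free⊆ ψ z z∈ψ })

    _∧ᶠ_ : FO2Formula s V → FO2Formula s V → FO2Formula s V
    φ ∧ᶠ ψ = fo2 (and (formula φ) (formula ψ)) (isFO2 φ , isFO2 ψ)
                 (λ { z (inj₁ z∈φ) → free⊆ φ z z∈φ ; z (inj₂ z∈ψ) → free⊆ ψ z z∈ψ })

  ⋀ⁱ : (n : ℕ) → (Fin n → Unary s) → Unary s
  ⋀ⁱ zero F = ⊤₁
  ⋀ⁱ (suc n) F = F zero ∧ᶠ ⋀ⁱ n (F ∘ suc)

  ⋁ : List (Unary s) → Unary s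
  ⋁ [] = ⊥₁
  ⋁ (χ ∷ χs) = χ ∨ᶠ ⋁ χs

  ⋁-vec : ∀ {A : Set} → List A → (n : ℕ) → (Vec A n → Unary s) → Unary s
  ⋁-vec cs zero F = F []
  ⋁-vec cs (suc n) F = ⋁ (map (λ c → ⋁-vec cs n (F ∘ (c ∷_))) cs)

  when : ∀ {A : Set} → Dec A → Unary s → Unary s
  when (yes _) χ = χ
  when (no _) χ = ⊤₁

  literal : Unary s → Bool → Unary s
  literal χ true = χ
  literal χ false = ¬₁ χ

  module _ (M : Model s) {p : ℕ} where

    ⊤₁-sat : M ⊨ ⊤₁ at p
    ⊤₁-sat = refl

    ⊥₁-unsat : ¬ M ⊨ ⊥₁ at p
    ⊥₁-unsat h = h refl

    ∧₁-sat : ∀ (χ ψ : Unary s) → M ⊨ χ ∧ᶠ ψ at p ⇔ (M ⊨ χ at p × M ⊨ ψ at p)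
    ∧₁-sat χ ψ = and-sat M (formula χ) (formula ψ)

    ∨₁-sat : ∀ (χ ψ : Unary s) → M ⊨ χ ∨ᶠ ψ at p ⇔ (¬ ¬ (M ⊨ χ at p ⊎ M ⊨ ψ at p))
    ∨₁-sat χ ψ = or-sat M (formula χ) (formula ψ)

    ⋀ⁱ-sat : ∀ n F → M ⊨ ⋀ⁱ n F at p ⇔ (∀ i → M ⊨ F i at p)
    ⋀ⁱ-sat zero F = mk⇔ (λ _ ()) (λ _ → ⊤₁-sat)
    ⋀ⁱ-sat (suc n) F = mk⇔
      (λ h → let (F₀ , F₊) = to (∧₁-sat (F zero) (⋀ⁱ n (F ∘ suc))) h in λ { zero → F₀ ; (suc i) → to (⋀ⁱ-sat n (F ∘ suc)) F₊ i })
      (λ h → from (∧₁-sat (F zero) (⋀ⁱ n (F ∘ suc))) (h zero , from (⋀ⁱ-sat n (F ∘ suc)) (h ∘ suc)))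

    ⋁-sat : ∀ χs → M ⊨ ⋁ χs at p ⇔ (¬ ¬ Any (M ⊨_at p) χs)
    ⋁-sat [] = mk⇔ (λ h → ⊥-elim (⊥₁-unsat h)) (λ h → ⊥-elim (h (λ ())))
    ⋁-sat (χ ∷ χs) = mk⇔
      (λ h → do
        inj₂ rest ← to (∨₁-sat χ (⋁ χs)) h
          where inj₁ χ✓ → return (here χ✓)
        there <$> to (⋁-sat χs) rest)
      (λ h → from (∨₁-sat χ (⋁ χs)) (do
        there rest ← h
          where here χ✓ → return (inj₁ χ✓)
        return (inj₂ (from (⋁-sat χs) (return rest)))))

    ⋁-vec-sat : ∀ {A : Set} (cs : List A) n F →
                M ⊨ ⋁-vec cs n F at p ⇔ (¬ ¬ Σ (Vec A n) λ v → All (_∈ cs) v × M ⊨ F v at p)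
    ⋁-vec-sat cs zero F = mk⇔ (λ h → return ([] , [] , h))
      (λ h → Sat-stable M _ (formula (F [])) (do ([] , [] , F✓) ← h ; return F✓))
    ⋁-vec-sat {A} cs (suc n) F = mk⇔
      (λ h → do
        some ← to (⋁-sat (map G cs)) h
        let (c , c∈cs , G✓) = find (Anyₚ.map⁻ some)
        (v , v∈cs , F✓) ← to (⋁-vec-sat cs n (F ∘ (c ∷_))) G✓
        return (c ∷ v , c∈cs ∷ v∈cs , F✓))
      (λ h → from (⋁-sat (map G cs)) (do
        (c ∷ v , c∈cs ∷ v∈cs , F✓) ← h
        return (Anyₚ.map⁺ (lose c∈cs (from (⋁-vec-sat cs n (F ∘ (c ∷_))) (return (v , v∈cs , F✓)))))))
      where
      G : A → Unary s
      G c = ⋁-vec cs n (F ∘ (c ∷_))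

    when-sat : ∀ {A : Set} (d : Dec A) χ → M ⊨ when d χ at p ⇔ (A → M ⊨ χ at p)
    when-sat (yes a) χ = mk⇔ (λ χ✓ _ → χ✓) (λ h → h a)
    when-sat (no ¬a) χ = mk⇔ (λ _ a → ⊥-elim (¬a a)) (λ _ → ⊤₁-sat)

    literal-sat : ∀ χ b → M ⊨ literal χ b at p ⇔ (T b ⇔ M ⊨ χ at p)
    literal-sat χ true = mk⇔ (λ χ✓ → mk⇔ (λ _ → χ✓) (λ _ → tt)) (λ h → to h tt)
    literal-sat χ false = mk⇔ (λ ¬χ → mk⇔ (λ ()) ¬χ) (λ h → from h)

  Gap : ∀ {A : Set} → Dec A → ℕ → ℕ → Formula s
  Gap (yes _) x y = succ x y
  Gap (no _) x y = and (lt x y) (neg (succ x y))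

  Gap-sat : ∀ (M : Model s) ρ {A : Set} (d : Dec A) x y →
            Sat M ρ (Gap d x y) ⇔ (ρ x < ρ y × (A ⇔ suc (ρ x) ≡ ρ y))
  Gap-sat M ρ (yes a) x y = mk⇔ (λ adj → ℕ.≤-reflexive adj , mk⇔ (λ _ → adj) (λ _ → a))
                                (λ (_ , a⇔adj) → to a⇔adj a)
  Gap-sat M ρ (no ¬a) x y = mk⇔
    (λ h → let (x<y , ¬adj) = to (and-sat M (lt x y) (neg (succ x y))) h
           in x<y , mk⇔ (λ a → ⊥-elim (¬a a)) (λ adj → ⊥-elim (¬adj adj)))
    (λ (x<y , a⇔adj) → from (and-sat M (lt x y) (neg (succ x y))) (x<y , ¬a ∘ from a⇔adj))

  Gap-FO2 : ∀ {A : Set} (d : Dec A) {x y} → x < 2 → y < 2 → FO2 (Gap d x y)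
  Gap-FO2 (yes _) x<2 y<2 = x<2 , y<2
  Gap-FO2 (no _) x<2 y<2 = (x<2 , y<2) , (x<2 , y<2)

  Gap-free : ∀ {A : Set} (d : Dec A) {x y} z → Free z (Gap d x y) → z ≡ x ⊎ z ≡ y
  Gap-free (yes _) z z∈ = z∈
  Gap-free (no _) z (inj₁ z∈) = z∈
  Gap-free (no _) z (inj₂ z∈) = z∈

  -- ∃y (R(x, y) ∧ ∃x (x = y ∧ χ(x))): the second quantifier moves x onto the witness.
  ◇ : Binary s → Unary s → Unary s
  ◇ R χ = fo2 (ex 1 (and (formula R) (ex 0 (and (eq 0 1) (formula χ)))))
              (s≤s (s≤s z≤n) , isFO2 R , s≤s z≤n , (s≤s z≤n , s≤s (s≤s z≤n)) , isFO2 χ)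
              bound
    where
    bound : ∀ z → Free z (ex 1 (and (formula R) (ex 0 (and (eq 0 1) (formula χ))))) → z ≡ 0
    bound z (z≢1 , inj₁ z∈R) with free⊆ R z z∈R
    ... | inj₁ z≡0 = z≡0
    ... | inj₂ z≡1 = ⊥-elim (z≢1 z≡1)
    bound z (z≢1 , inj₂ (z≢0 , inj₁ (inj₁ z≡0))) = ⊥-elim (z≢0 z≡0)
    bound z (z≢1 , inj₂ (z≢0 , inj₁ (inj₂ z≡1))) = ⊥-elim (z≢1 z≡1)
    bound z (z≢1 , inj₂ (z≢0 , inj₂ z∈χ)) = ⊥-elim (z≢0 (free⊆ χ z z∈χ))

  ◇-sat : ∀ (M : Model s) R χ {p} →
          M ⊨ ◇ R χ at p ⇔ (¬ ¬ Σ ℕ λ q → InDom M q × M ⊨ R at⟨ p , q ⟩ × M ⊨ χ at q)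
  ◇-sat M R χ {p} = mk⇔
    (λ h → do
      (q , q∈M , body) ← to (ex-sat M 1 (and (formula R) onward)) h
      let (R✓ , onward✓) = to (and-sat M (formula R) onward) body
      (q′ , _ , at✓) ← to (ex-sat M 0 (and (eq 0 1) (formula χ))) onward✓
      let (q′≡q , χ✓) = to (and-sat M (eq 0 1) (formula χ)) at✓
      return (q , q∈M , to (binary-sat M _ R) R✓ , subst (M ⊨ χ at_) q′≡q (to (unary-sat M _ χ) χ✓)))
    (λ h → from (ex-sat M 1 (and (formula R) onward)) (do
      (q , q∈M , R✓ , χ✓) ← h
      return (q , q∈M , from (and-sat M (formula R) onward)
        (from (binary-sat M _ R) R✓ ,
         from (ex-sat M 0 (and (eq 0 1) (formula χ))) (return (q , q∈M ,
           from (and-sat M (eq 0 1) (formula χ)) (refl , from (unary-sat M _ χ) χ✓)))))))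
    where
    onward : Formula s
    onward = ex 0 (and (eq 0 1) (formula χ))

Preserves : ℕ → ℕ → ℕ → ℕ → Set
Preserves a b x y = (a < b → x < y) × (suc a ≡ b ⇔ suc x ≡ y)

PairEmbeds : ℕ → ℕ → ℕ → ℕ → Set
PairEmbeds a b x y = Preserves a b x y × Preserves b a y x

Embeds : (ℕ → ℕ) → (ℕ → Set) → Set
Embeds w S = ∀ {a b} → S a → S b → Preserves a b (w a) (w b)

Preserves-refl : ∀ {a x} → Preserves a a x x
Preserves-refl = (λ a<a → ⊥-elim (ℕ.<-irrefl refl a<a)) , mk⇔ (⊥-elim ∘ ℕ.1+n≢n) (⊥-elim ∘ ℕ.1+n≢n)

PairEmbeds-sym : ∀ {a b x y} → PairEmbeds a b x y → PairEmbeds b a y x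
PairEmbeds-sym (ab , ba) = ba , ab

PairEmbeds-adjacent : ∀ {a b x y} → a < b → x < y → (suc a ≡ b ⇔ suc x ≡ y) → PairEmbeds a b x y
PairEmbeds-adjacent {a} {b} {x} {y} a<b x<y adj =
  ((λ _ → x<y) , adj) ,
  ((λ b<a → ⊥-elim (ℕ.<-asym a<b b<a)) ,
   mk⇔ (λ e → ⊥-elim (ℕ.<-asym a<b (subst (b <_) e (ℕ.n<1+n b))))
       (λ e → ⊥-elim (ℕ.<-asym x<y (subst (y <_) e (ℕ.n<1+n y)))))

PairEmbeds-apart : ∀ {a c x z} → suc a < c → suc x < z → PairEmbeds a c x z
PairEmbeds-apart {a} {c} {x} {z} a≪c x≪z =
  ((λ _ → ℕ.<-trans (ℕ.n<1+n x) x≪z) , mk⇔ (λ e → ⊥-elim (ℕ.<⇒≢ a≪c e)) (λ e → ⊥-elim (ℕ.<⇒≢ x≪z e))) ,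
  ((λ c<a → ⊥-elim (ℕ.<-asym c<a a<c)) ,
   mk⇔ (λ e → ⊥-elim (ℕ.<-asym a<c (subst (c <_) e (ℕ.n<1+n c))))
       (λ e → ⊥-elim (ℕ.<-asym (ℕ.<-trans (ℕ.n<1+n x) x≪z) (subst (z <_) e (ℕ.n<1+n z)))))
  where
  a<c : a < c
  a<c = ℕ.<-trans (ℕ.n<1+n a) a≪c

data Direction : Set where
  ascending descending : Direction

_≺⟨_⟩_ : ℕ → Direction → ℕ → Set
a ≺⟨ ascending ⟩ b = a < b
a ≺⟨ descending ⟩ b = b < a

≺-trans : ∀ d {a b c} → a ≺⟨ d ⟩ b → b ≺⟨ d ⟩ c → a ≺⟨ d ⟩ c
≺-trans ascending a<b b<c = ℕ.<-trans a<b b<c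
≺-trans descending b<a c<b = ℕ.<-trans c<b b<a

≺⇒≢ : ∀ d {a b} → a ≺⟨ d ⟩ b → b ≢ a
≺⇒≢ ascending a<b = ℕ.>⇒≢ a<b
≺⇒≢ descending b<a = ℕ.<⇒≢ b<a

PairEmbeds-trans : ∀ d {a b c x y z} → a ≺⟨ d ⟩ b → b ≺⟨ d ⟩ c →
                   PairEmbeds a b x y → PairEmbeds b c y z → PairEmbeds a c x z
PairEmbeds-trans ascending a<b b<c (ab , _) (bc , _) =
  PairEmbeds-apart (ℕ.≤-<-trans a<b b<c) (ℕ.≤-<-trans (proj₁ ab a<b) (proj₁ bc b<c))
PairEmbeds-trans descending b<a c<b (_ , ba) (_ , cb) =
  PairEmbeds-sym (PairEmbeds-apart (ℕ.≤-<-trans c<b b<a) (ℕ.≤-<-trans (proj₁ cb c<b) (proj₁ ba b<a)))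

Embeds-⊆ : ∀ {w} {S T : ℕ → Set} → (∀ {a} → T a → S a) → Embeds w S → Embeds w T
Embeds-⊆ T⊆S emb a∈ b∈ = emb (T⊆S a∈) (T⊆S b∈)

Embeds-insert : ∀ {w ts pv p} → Embeds w (_∈ ts) → (∀ {b} → b ∈ ts → b ≢ pv) →
                (∀ {b} → b ∈ ts → PairEmbeds pv b p (w b)) → Embeds (w [ pv ↦ p ]) (_∈ pv ∷ ts)
Embeds-insert {w} {ts} {pv} {p} emb fresh new = embeds
  where
  old : ∀ {a} → a ∈ ts → (w [ pv ↦ p ]) a ≡ w a
  old a∈ = upd-other w p (fresh a∈)
  embeds : Embeds (w [ pv ↦ p ]) (_∈ pv ∷ ts)
  embeds (here refl) (here refl) = Preserves-refl
  embeds (here refl) (there b∈) = subst₂ (Preserves pv _) (sym (upd-same w pv p)) (sym (old b∈)) (proj₁ (new b∈))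
  embeds (there a∈) (here refl) = subst₂ (Preserves _ pv) (sym (old a∈)) (sym (upd-same w pv p)) (proj₂ (new a∈))
  embeds (there a∈) (there b∈) = subst₂ (Preserves _ _) (sym (old a∈)) (sym (old b∈)) (emb a∈ b∈)

Embeds-singleton : ∀ {w pv} → Embeds w (_∈ pv ∷ [])
Embeds-singleton (here refl) (here refl) = Preserves-refl

Embeds-cong : ∀ {w w′} {S : ℕ → Set} → (∀ {a} → S a → w a ≡ w′ a) → Embeds w S → Embeds w′ S
Embeds-cong w≗w′ emb a∈ b∈ = subst₂ (Preserves _ _) (w≗w′ a∈) (w≗w′ b∈) (emb a∈ b∈)

Embeds-∪ : ∀ {w c} {A B : ℕ → Set} → Embeds w A → Embeds w B → A c → B c →
           (∀ {a} → A a → a ≤ c) → (∀ {b} → B b → c ≤ b) → Embeds w (λ a → A a ⊎ B a)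
Embeds-∪ {w} {c} {A} {B} embA embB c∈A c∈B A≤c c≤B = embeds
  where
  cross : ∀ {a b} → A a → B b → PairEmbeds a b (w a) (w b)
  cross a∈ b∈ with ℕ.m≤n⇒m<n∨m≡n (A≤c a∈) | ℕ.m≤n⇒m<n∨m≡n (c≤B b∈)
  ... | inj₂ refl | _ = embB c∈B b∈ , embB b∈ c∈B
  ... | inj₁ _ | inj₂ refl = embA a∈ c∈A , embA c∈A a∈
  ... | inj₁ a<c | inj₁ c<b =
    PairEmbeds-trans ascending a<c c<b (embA a∈ c∈A , embA c∈A a∈) (embB c∈B b∈ , embB b∈ c∈B)
  embeds : Embeds w (λ a → A a ⊎ B a)
  embeds (inj₁ a∈) (inj₁ b∈) = embA a∈ b∈
  embeds (inj₁ a∈) (inj₂ b∈) = proj₁ (cross a∈ b∈)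
  embeds (inj₂ a∈) (inj₁ b∈) = proj₂ (cross b∈ a∈)
  embeds (inj₂ a∈) (inj₂ b∈) = embB a∈ b∈

linked-≺ : ∀ d {x xs} → Linked (_≺⟨ d ⟩_) (x ∷ xs) → ∀ {b} → b ∈ xs → x ≺⟨ d ⟩ b
linked-≺ d [-] ()
linked-≺ d (x≺y ∷ linked) = ListAll.lookup (Linked⇒All (≺-trans d) x≺y linked)

Embeds-cons : ∀ d {w pv t ts p} → Linked (_≺⟨ d ⟩_) (pv ∷ t ∷ ts) → PairEmbeds pv t p (w t) →
              Embeds w (_∈ t ∷ ts) → Embeds (w [ pv ↦ p ]) (_∈ pv ∷ t ∷ ts)
Embeds-cons d {w} {pv} {t} {ts} {p} linked@(pv≺t ∷ linked′) first emb =
  Embeds-insert emb (λ b∈ → ≺⇒≢ d (linked-≺ d linked b∈)) pair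
  where
  pair : ∀ {b} → b ∈ t ∷ ts → PairEmbeds pv b p (w b)
  pair (here refl) = first
  pair (there b∈) = PairEmbeds-trans d pv≺t (linked-≺ d linked′ b∈) first
                      (emb (here refl) (there b∈) , emb (there b∈) (here refl))

-- Walks through a finite set of positions

module _ {s : ℕ} where

  step : Direction → ℕ → ℕ → Binary s
  step ascending pv t =
    fo2 (Gap (suc pv ≟ t) 0 1) (Gap-FO2 (suc pv ≟ t) (s≤s z≤n) (s≤s (s≤s z≤n))) (Gap-free (suc pv ≟ t))
  step descending pv t =
    fo2 (Gap (suc t ≟ pv) 1 0) (Gap-FO2 (suc t ≟ pv) (s≤s (s≤s z≤n)) (s≤s z≤n)) (λ z → swap ∘ Gap-free (suc t ≟ pv) z)

  step-sat : ∀ (M : Model s) d {pv t p q} → pv ≺⟨ d ⟩ t → M ⊨ step d pv t at⟨ p , q ⟩ ⇔ PairEmbeds pv t p q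
  step-sat M ascending {pv} {t} {p} {q} pv<t = mk⇔
    (λ h → let (p<q , adj) = to (Gap-sat M ⟨ p , q ⟩ (suc pv ≟ t) 0 1) h in PairEmbeds-adjacent pv<t p<q adj)
    (λ ((pres , adj) , _) → from (Gap-sat M ⟨ p , q ⟩ (suc pv ≟ t) 0 1) (pres pv<t , adj))
  step-sat M descending {pv} {t} {p} {q} t<pv = mk⇔
    (λ h → let (q<p , adj) = to (Gap-sat M ⟨ p , q ⟩ (suc t ≟ pv) 1 0) h in
           PairEmbeds-sym (PairEmbeds-adjacent t<pv q<p adj))
    (λ (_ , (pres , adj)) → from (Gap-sat M ⟨ p , q ⟩ (suc t ≟ pv) 1 0) (pres t<pv , adj))

module Walk {s : ℕ} (Λ : ℕ → Unary s) where

  walk : Direction → ℕ → List ℕ → Unary s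
  walk d pv [] = ⊤₁
  walk d pv (t ∷ ts) = ◇ (step d pv t) (Λ t ∧ᶠ walk d t ts)

  module _ (M : Model s) where

    Label : ℕ → ℕ → Set
    Label a v = InDom M v × M ⊨ Λ a at v

    Labelled : (ℕ → ℕ) → (ℕ → Set) → Set
    Labelled w S = ∀ {a} → S a → Label a (w a)

    Labelled-∷ : ∀ {w t ts} → Label t (w t) → Labelled w (_∈ ts) → Labelled w (_∈ t ∷ ts)
    Labelled-∷ here✓ _ (here refl) = here✓
    Labelled-∷ _ labelled (there a∈) = labelled a∈

    Labelled-upd : ∀ {w pv p} {S : ℕ → Set} → (∀ {a} → S a → a ≢ pv) → Labelled w S → Labelled (w [ pv ↦ p ]) S
    Labelled-upd {w} {p = p} fresh labelled a∈ = subst (Label _) (sym (upd-other w p (fresh a∈))) (labelled a∈)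

    walk-sound : ∀ d {pv ts p} → Linked (_≺⟨ d ⟩_) (pv ∷ ts) → M ⊨ walk d pv ts at p →
                 ¬ ¬ Σ (ℕ → ℕ) λ w → w pv ≡ p × Labelled w (_∈ ts) × Embeds w (_∈ pv ∷ ts)
    walk-sound d {ts = []} {p} _ _ = return ((λ _ → p) , refl , (λ ()) , (λ {a} {b} → Embeds-singleton {a = a} {b}))
    walk-sound d {pv} {t ∷ ts} {p} linked@(pv≺t ∷ linked′) h = do
      (q , q∈M , step✓ , next✓) ← to (◇-sat M (step d pv t) (Λ t ∧ᶠ walk d t ts)) h
      let (Λ✓ , rest✓) = to (∧₁-sat M (Λ t) (walk d t ts)) next✓
      (w , wt≡q , labelled , embeds) ← walk-sound d linked′ rest✓
      let first = subst (PairEmbeds pv t p) (sym wt≡q) (to (step-sat M d pv≺t) step✓)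
      return (w [ pv ↦ p ] , upd-same w pv p ,
              (λ {a} → Labelled-upd (λ a∈ → ≺⇒≢ d (linked-≺ d linked a∈))
                 (Labelled-∷ (subst (Label t) (sym wt≡q) (q∈M , Λ✓)) labelled) {a}) ,
              (λ {a} {b} → Embeds-cons d linked first embeds {a} {b}))

    walk-complete : ∀ d {pv ts w} → Linked (_≺⟨ d ⟩_) (pv ∷ ts) → Embeds w (_∈ pv ∷ ts) →
                    Labelled w (_∈ ts) → M ⊨ walk d pv ts at w pv
    walk-complete d {ts = []} _ _ _ = ⊤₁-sat M
    walk-complete d {pv} {t ∷ ts} {w} (pv≺t ∷ linked) embeds labelled =
      from (◇-sat M (step d pv t) (Λ t ∧ᶠ walk d t ts)) (return (w t , proj₁ (labelled (here refl)) ,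
        from (step-sat M d pv≺t) (embeds (here refl) (there (here refl)) , embeds (there (here refl)) (here refl)) ,
        from (∧₁-sat M (Λ t) (walk d t ts))
          (proj₂ (labelled (here refl)) , walk-complete d linked (Embeds-⊆ there embeds) (labelled ∘ there))))

Linked-∷ : ∀ {R : ℕ → ℕ → Set} {x ys} → (∀ {y} → y ∈ ys → R x y) → Linked R ys → Linked R (x ∷ ys)
Linked-∷ {ys = []} _ _ = [-]
Linked-∷ {ys = y ∷ _} x≺ys linked = x≺ys (here refl) ∷ linked

splice : ℕ → (ℕ → ℕ) → (ℕ → ℕ) → ℕ → ℕ
splice c wL wR t with t <? c
... | yes _ = wL t
... | no _ = wR t

splice-< : ∀ {c t} wL wR → t < c → splice c wL wR t ≡ wL t
splice-< {c} {t} wL wR t<c with t <? c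
... | yes _ = refl
... | no t≮c = ⊥-elim (t≮c t<c)

splice-≥ : ∀ {c t} wL wR → c ≤ t → splice c wL wR t ≡ wR t
splice-≥ {c} {t} wL wR c≤t with t <? c
... | yes t<c = ⊥-elim (ℕ.≤⇒≯ c≤t t<c)
... | no _ = refl

module Chain {s : ℕ} (O : ℕ → Set) (O? : ∀ t → Dec (O t)) (Λ : ℕ → Unary s) (bound u₀ : ℕ) where
  open Walk Λ

  below : List ℕ
  below = filter O? (downFrom u₀)

  beyond? : ∀ t → Dec (u₀ < t × O t)
  beyond? t = (u₀ <? t) ×-dec O? t

  above : List ℕ
  above = filter beyond? (upTo (suc bound))

  leftWalk rightWalk chain : Unary s
  leftWalk = walk descending u₀ below
  rightWalk = walk ascending u₀ above
  chain = Λ u₀ ∧ᶠ (leftWalk ∧ᶠ rightWalk)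

  below< : ∀ {t} → t ∈ below → t < u₀
  below< t∈ = ∈-downFrom⁻ (proj₁ (∈-filter⁻ O? {xs = downFrom u₀} t∈))

  above> : ∀ {t} → t ∈ above → u₀ < t
  above> t∈ = proj₁ (proj₂ (∈-filter⁻ beyond? {xs = upTo (suc bound)} t∈))

  below-linked : Linked (_≺⟨ descending ⟩_) (u₀ ∷ below)
  below-linked = Linked-∷ below< (filter⁺ O? (≺-trans descending) (applyDownFrom⁺₂ id u₀ ℕ.n<1+n))

  above-linked : Linked (_≺⟨ ascending ⟩_) (u₀ ∷ above)
  above-linked = Linked-∷ above> (filter⁺ beyond? ℕ.<-trans (applyUpTo⁺₂ id (suc bound) ℕ.n<1+n))

  below⊆O : O u₀ → ∀ {t} → t ∈ u₀ ∷ below → O t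
  below⊆O O-u₀ (here refl) = O-u₀
  below⊆O _ (there t∈) = proj₂ (∈-filter⁻ O? {xs = downFrom u₀} t∈)

  above⊆O : O u₀ → ∀ {t} → t ∈ u₀ ∷ above → O t
  above⊆O O-u₀ (here refl) = O-u₀
  above⊆O _ (there t∈) = proj₂ (proj₂ (∈-filter⁻ beyond? {xs = upTo (suc bound)} t∈))

  below≤ : ∀ {t} → t ∈ u₀ ∷ below → t ≤ u₀
  below≤ (here refl) = ℕ.≤-refl
  below≤ (there t∈) = ℕ.<⇒≤ (below< t∈)

  above≥ : ∀ {t} → t ∈ u₀ ∷ above → u₀ ≤ t
  above≥ (here refl) = ℕ.≤-refl
  above≥ (there t∈) = ℕ.<⇒≤ (above> t∈)

  O⊆below∪above : (∀ {t} → O t → t ≤ bound) → ∀ {t} → O t → t ∈ u₀ ∷ below ⊎ t ∈ u₀ ∷ above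
  O⊆below∪above O≤ {t} O-t with ℕ.<-cmp t u₀
  ... | tri< t<u₀ _ _ = inj₁ (there (∈-filter⁺ O? (∈-downFrom⁺ t<u₀) O-t))
  ... | tri≈ _ refl _ = inj₁ (here refl)
  ... | tri> _ _ u₀<t = inj₂ (there (∈-filter⁺ beyond? (∈-upTo⁺ (s≤s (O≤ O-t))) (u₀<t , O-t)))

  module _ (M : Model s) where

    splice-embeds : ∀ {wL wR} → wL u₀ ≡ wR u₀ → (∀ {t} → O t → t ≤ bound) →
                    Embeds wL (_∈ u₀ ∷ below) → Embeds wR (_∈ u₀ ∷ above) → Embeds (splice u₀ wL wR) O
    splice-embeds {wL} {wR} wL≡wR O≤ embL embR =
      Embeds-⊆ (O⊆below∪above O≤) (Embeds-∪ (Embeds-cong onBelow embL) (Embeds-cong onAbove embR)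
                                             (here refl) (here refl) below≤ above≥)
      where
      onBelow : ∀ {t} → t ∈ u₀ ∷ below → wL t ≡ splice u₀ wL wR t
      onBelow (here refl) = trans wL≡wR (sym (splice-≥ wL wR ℕ.≤-refl))
      onBelow (there t∈) = sym (splice-< wL wR (below< t∈))
      onAbove : ∀ {t} → t ∈ u₀ ∷ above → wR t ≡ splice u₀ wL wR t
      onAbove t∈ = sym (splice-≥ wL wR (above≥ t∈))

    splice-labelled : ∀ wL wR → (∀ {t} → O t → t ≤ bound) → Label M u₀ (wR u₀) →
                      Labelled M wL (_∈ below) → Labelled M wR (_∈ above) → Labelled M (splice u₀ wL wR) O
    splice-labelled wL wR O≤ anchor labL labR O-t with O⊆below∪above O≤ O-t
    ... | inj₁ (here refl) = subst (Label M u₀) (sym (splice-≥ wL wR ℕ.≤-refl)) anchor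
    ... | inj₁ (there t∈) = subst (Label M _) (sym (splice-< wL wR (below< t∈))) (labL t∈)
    ... | inj₂ (here refl) = subst (Label M u₀) (sym (splice-≥ wL wR ℕ.≤-refl)) anchor
    ... | inj₂ (there t∈) = subst (Label M _) (sym (splice-≥ wL wR (above≥ (there t∈)))) (labR t∈)

    chain-sound : ∀ {a} → (∀ {t} → O t → t ≤ bound) → InDom M a → M ⊨ chain at a →
                  ¬ ¬ Σ (ℕ → ℕ) λ w → w u₀ ≡ a × Labelled M w O × Embeds w O
    chain-sound {a} O≤ a∈M h = do
      let (Λ✓ , walks✓) = to (∧₁-sat M (Λ u₀) (leftWalk ∧ᶠ rightWalk)) h
          (left✓ , right✓) = to (∧₁-sat M leftWalk rightWalk) walks✓
      (wL , wL≡a , labL , embL) ← walk-sound M descending below-linked left✓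
      (wR , wR≡a , labR , embR) ← walk-sound M ascending above-linked right✓
      return (splice u₀ wL wR , trans (splice-≥ wL wR ℕ.≤-refl) wR≡a ,
              (λ {t} → splice-labelled wL wR O≤ (subst (Label M u₀) (sym wR≡a) (a∈M , Λ✓)) labL labR {t}) ,
              (λ {t} {t′} → splice-embeds (trans wL≡a (sym wR≡a)) O≤ embL embR {t} {t′}))

    chain-complete : ∀ {w} → O u₀ → Embeds w O → Labelled M w O → M ⊨ chain at w u₀
    chain-complete O-u₀ emb lab =
      from (∧₁-sat M (Λ u₀) (leftWalk ∧ᶠ rightWalk)) (proj₂ (lab O-u₀) ,
        from (∧₁-sat M leftWalk rightWalk)
          (walk-complete M descending below-linked (Embeds-⊆ (below⊆O O-u₀) emb) (lab ∘ below⊆O O-u₀ ∘ there) ,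
           walk-complete M ascending above-linked (Embeds-⊆ (above⊆O O-u₀) emb) (lab ∘ above⊆O O-u₀ ∘ there)))

-- Order types and their compression

SameType : List ℕ → (ℕ → ℕ) → (ℕ → ℕ) → Set
SameType L g u = ∀ {x y} → x ∈ L → y ∈ L → (g x < g y ⇔ u x < u y) × (suc (g x) ≡ g y ⇔ suc (u x) ≡ u y)

SameType-cong : ∀ {L g u u′} → (∀ {x} → x ∈ L → u′ x ≡ u x) → SameType L g u → SameType L g u′
SameType-cong {g = g} u′≗u same x∈ y∈ =
  subst₂ (λ v v′ → (g _ < g _ ⇔ v < v′) × (suc (g _) ≡ g _ ⇔ suc v ≡ v′)) (sym (u′≗u x∈)) (sym (u′≗u y∈)) (same x∈ y∈)

SameType-sym : ∀ {L g u} → SameType L g u → SameType L u g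
SameType-sym same x∈ y∈ = let (<⇔ , adj⇔) = same x∈ y∈ in ⇔-sym <⇔ , ⇔-sym adj⇔

SameType-≡ : ∀ {L g u x y} → SameType L g u → x ∈ L → y ∈ L → g x ≡ g y → u x ≡ u y
SameType-≡ {u = u} {x} {y} same x∈ y∈ gx≡gy with ℕ.<-cmp (u x) (u y)
... | tri< ux<uy _ _ = ⊥-elim (ℕ.<⇒≢ (from (proj₁ (same x∈ y∈)) ux<uy) gx≡gy)
... | tri≈ _ ux≡uy _ = ux≡uy
... | tri> _ _ uy<ux = ⊥-elim (ℕ.>⇒≢ (from (proj₁ (same y∈ x∈)) uy<ux) gx≡gy)

indicator : ∀ {A : Set} → Dec A → ℕ
indicator (yes _) = 1
indicator (no _) = 0

indicator-≤1 : ∀ {A : Set} (a? : Dec A) → indicator a? ≤ 1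
indicator-≤1 (yes _) = ℕ.≤-refl
indicator-≤1 (no _) = z≤n

indicator-⊎ : ∀ {A B C : Set} → (A → B ⊎ C) → (a? : Dec A) (b? : Dec B) (c? : Dec C) →
              indicator a? ≤ indicator b? + indicator c?
indicator-⊎ A⇒B⊎C (no _) b? c? = z≤n
indicator-⊎ A⇒B⊎C (yes a) (yes _) c? = s≤s z≤n
indicator-⊎ A⇒B⊎C (yes a) (no ¬b) (yes _) = s≤s z≤n
indicator-⊎ A⇒B⊎C (yes a) (no ¬b) (no ¬c) with A⇒B⊎C a
... | inj₁ b = ⊥-elim (¬b b)
... | inj₂ c = ⊥-elim (¬c c)

sumBelow : (ℕ → ℕ) → ℕ → ℕ
sumBelow h zero = 0
sumBelow h (suc d) = sumBelow h d + h d

sumBelow-zero : ∀ d → sumBelow (λ _ → 0) d ≡ 0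
sumBelow-zero zero = refl
sumBelow-zero (suc d) = trans (ℕ.+-identityʳ _) (sumBelow-zero d)

sumBelow-mono : ∀ h {d e} → d ≤ e → sumBelow h d ≤ sumBelow h e
sumBelow-mono h {e = zero} z≤n = z≤n
sumBelow-mono h {d} {suc e} d≤1+e with ℕ.m≤n⇒m<n∨m≡n d≤1+e
... | inj₁ d<1+e = ℕ.≤-trans (sumBelow-mono h (ℕ.≤-pred d<1+e)) (ℕ.m≤m+n (sumBelow h e) (h e))
... | inj₂ refl = ℕ.≤-refl

sumBelow-≤ : ∀ {h h′} → (∀ e → h e ≤ h′ e) → ∀ d → sumBelow h d ≤ sumBelow h′ d
sumBelow-≤ h≤h′ zero = z≤n
sumBelow-≤ h≤h′ (suc d) = ℕ.+-mono-≤ (sumBelow-≤ h≤h′ d) (h≤h′ d)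

sumBelow-+ : ∀ h h′ d → sumBelow (λ e → h e + h′ e) d ≡ sumBelow h d + sumBelow h′ d
sumBelow-+ h h′ zero = refl
sumBelow-+ h h′ (suc d) =
  trans (cong (_+ (h d + h′ d)) (sumBelow-+ h h′ d)) (interchange (sumBelow h d) (sumBelow h′ d) (h d) (h′ d))

sumBelow-point : ∀ c d → sumBelow (λ e → indicator (c ≟ e)) d ≡ indicator (c <? d)
sumBelow-point c zero = refl
sumBelow-point c (suc d) rewrite sumBelow-point c d with c <? d | c ≟ d | c <? suc d
... | yes _ | no _ | yes _ = refl
... | no _ | yes _ | yes _ = refl
... | no _ | no _ | no _ = refl
... | yes c<d | yes refl | _ = ⊥-elim (ℕ.<-irrefl refl c<d)
... | yes c<d | _ | no c≮1+d = ⊥-elim (c≮1+d (ℕ.m<n⇒m<1+n c<d))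
... | no _ | yes refl | no c≮1+c = ⊥-elim (c≮1+c (ℕ.n<1+n c))
... | no c≮d | no c≢d | yes c<1+d with ℕ.m<1+n⇒m<n∨m≡n c<1+d
...   | inj₁ c<d = ⊥-elim (c≮d c<d)
...   | inj₂ c≡d = ⊥-elim (c≢d c≡d)

distinct-values-≤ : ∀ (g : ℕ → ℕ) L d → sumBelow (λ e → indicator (any? (λ x → g x ≟ e) L)) d ≤ length L
distinct-values-≤ g [] d = ℕ.≤-reflexive (sumBelow-zero d)
distinct-values-≤ g (x ∷ L) d = begin
  sumBelow (λ e → indicator (any? (λ y → g y ≟ e) (x ∷ L))) d
    ≤⟨ sumBelow-≤ (λ e → indicator-⊎ Any.toSum (any? _ (x ∷ L)) (g x ≟ e) (any? _ L)) d ⟩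
  sumBelow (λ e → indicator (g x ≟ e) + indicator (any? (λ y → g y ≟ e) L)) d
    ≡⟨ sumBelow-+ _ _ d ⟩
  sumBelow (λ e → indicator (g x ≟ e)) d + sumBelow (λ e → indicator (any? (λ y → g y ≟ e) L)) d
    ≤⟨ ℕ.+-mono-≤ (ℕ.≤-trans (ℕ.≤-reflexive (sumBelow-point (g x) d)) (indicator-≤1 (g x <? d)))
                  (distinct-values-≤ g L d) ⟩
  suc (length L) ∎
  where open ℕ.≤-Reasoning

module Compression (g : ℕ → ℕ) (L : List ℕ) where

  Used : ℕ → Set
  Used d = Any (λ x → g x ≡ d) L

  used? : ∀ d → Dec (Used d)
  used? d = any? (λ x → g x ≟ d) L

  -- A used value followed by an unused one weighs 2, so that gaps are not closed.
  weight : ℕ → ℕ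
  weight d with used? d | used? (suc d)
  ... | no _ | _ = 0
  ... | yes _ | yes _ = 1
  ... | yes _ | no _ = 2

  rank : ℕ → ℕ
  rank = sumBelow weight

  compress : ℕ → ℕ
  compress x = rank (g x)

  weight-≤ : ∀ d → weight d ≤ indicator (used? d) + indicator (used? d)
  weight-≤ d with used? d | used? (suc d)
  ... | no _ | _ = z≤n
  ... | yes _ | yes _ = s≤s z≤n
  ... | yes _ | no _ = ℕ.≤-refl

  weight-pos : ∀ {d} → Used d → 0 < weight d
  weight-pos {d} u with used? d | used? (suc d)
  ... | no ¬u | _ = ⊥-elim (¬u u)
  ... | yes _ | yes _ = s≤s z≤n
  ... | yes _ | no _ = s≤s z≤n

  weight-adjacent : ∀ {d} → Used d → Used (suc d) → weight d ≡ 1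
  weight-adjacent {d} u u′ with used? d | used? (suc d)
  ... | no ¬u | _ = ⊥-elim (¬u u)
  ... | yes _ | no ¬u′ = ⊥-elim (¬u′ u′)
  ... | yes _ | yes _ = refl

  weight-gap : ∀ {d} → Used d → 2 ≤ weight d + weight (suc d)
  weight-gap {d} u with used? d | used? (suc d) | weight-pos {suc d}
  ... | no ¬u | _ | _ = ⊥-elim (¬u u)
  ... | yes _ | yes u′ | pos = s≤s (pos u′)
  ... | yes _ | no _ | _ = s≤s (s≤s z≤n)

  rank-bound : ∀ d → rank d ≤ length L + length L
  rank-bound d = begin
    rank d                                                  ≤⟨ sumBelow-≤ weight-≤ d ⟩
    sumBelow (λ e → indicator (used? e) + indicator (used? e)) d ≡⟨ sumBelow-+ _ _ d ⟩
    sumBelow (indicator ∘ used?) d + sumBelow (indicator ∘ used?) d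
      ≤⟨ ℕ.+-mono-≤ (distinct-values-≤ g L d) (distinct-values-≤ g L d) ⟩
    length L + length L                                     ∎
    where open ℕ.≤-Reasoning

  rank-< : ∀ {d e} → Used d → d < e → rank d < rank e
  rank-< u d<e = ℕ.<-≤-trans (ℕ.m<m+n _ (weight-pos u)) (sumBelow-mono weight d<e)

  rank-<⁻ : ∀ {d e} → rank d < rank e → d < e
  rank-<⁻ {d} {e} rd<re with d <? e
  ... | yes d<e = d<e
  ... | no d≮e = ⊥-elim (ℕ.<⇒≱ rd<re (sumBelow-mono weight (ℕ.≮⇒≥ d≮e)))

  rank-adjacent : ∀ {d} → Used d → Used (suc d) → suc (rank d) ≡ rank (suc d)
  rank-adjacent {d} u u′ = trans (ℕ.+-comm 1 (rank d)) (cong (rank d +_) (sym (weight-adjacent u u′)))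

  rank-adjacent⁻ : ∀ {d e} → Used d → suc (rank d) ≡ rank e → suc d ≡ e
  rank-adjacent⁻ {d} {e} u adj with ℕ.m≤n⇒m<n∨m≡n (rank-<⁻ {d} {e} (ℕ.≤-reflexive adj))
  ... | inj₂ 1+d≡e = 1+d≡e
  ... | inj₁ 1+d<e = ⊥-elim (ℕ.<-irrefl adj (begin-strict
    suc (rank d)                      <⟨ ℕ.n<1+n _ ⟩
    2 + rank d                        ≡⟨ ℕ.+-comm 2 (rank d) ⟩
    rank d + 2                        ≤⟨ ℕ.+-monoʳ-≤ (rank d) (weight-gap u) ⟩
    rank d + (weight d + weight (suc d)) ≡⟨ ℕ.+-assoc (rank d) _ _ ⟨
    rank (suc (suc d))                ≤⟨ sumBelow-mono weight 1+d<e ⟩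
    rank e                            ∎))
    where open ℕ.≤-Reasoning

  compress-sameType : SameType L g compress
  compress-sameType x∈ y∈ =
    mk⇔ (rank-< (used x∈)) rank-<⁻ ,
    mk⇔ (λ adj → trans (rank-adjacent (used x∈) (subst Used (sym adj) (used y∈))) (cong rank adj))
        (rank-adjacent⁻ (used x∈))
    where
    used : ∀ {x} → x ∈ L → Used (g x)
    used = Any.map (λ x≡z → cong g (sym x≡z))

True⇔ : ∀ {A : Set} (a? : Dec A) → True a? ⇔ A
True⇔ a? = mk⇔ toWitness fromWitness

T-∨ : ∀ {A B : Set} p q → (T p ⇔ A) → (T q ⇔ B) → T (p ∨ q) ⇔ (¬ (¬ A × ¬ B))
T-∨ true q p⇔A q⇔B = mk⇔ (λ _ (¬A , _) → ¬A (to p⇔A tt)) (λ _ → tt)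
T-∨ false true p⇔A q⇔B = mk⇔ (λ _ (_ , ¬B) → ¬B (to q⇔B tt)) (λ _ → tt)
T-∨ false false p⇔A q⇔B = mk⇔ (λ ()) (λ ¬¬A⊎B → ¬¬A⊎B (from p⇔A , from q⇔B))

T-not : ∀ {A : Set} p → (T p ⇔ A) → T (not p) ⇔ (¬ A)
T-not true p⇔A = mk⇔ (λ ()) (λ ¬A → ¬A (to p⇔A tt))
T-not false p⇔A = mk⇔ (λ _ → from p⇔A) (λ _ → tt)

data BoolComb (s : ℕ) : Set where
  lt′ succ′ eq′ : ℕ → ℕ → BoolComb s
  or′ : BoolComb s → BoolComb s → BoolComb s
  neg′ : BoolComb s → BoolComb s
  at′ : Unary s → ℕ → BoolComb s

module _ {s : ℕ} where

  ⟦_⟧ : BoolComb s → Model s → (ℕ → ℕ) → Set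
  ⟦ lt′ x y ⟧ M g = g x < g y
  ⟦ succ′ x y ⟧ M g = suc (g x) ≡ g y
  ⟦ eq′ x y ⟧ M g = g x ≡ g y
  ⟦ or′ b c ⟧ M g = ¬ (¬ ⟦ b ⟧ M g × ¬ ⟦ c ⟧ M g)
  ⟦ neg′ b ⟧ M g = ¬ ⟦ b ⟧ M g
  ⟦ at′ χ x ⟧ M g = M ⊨ χ at g x

  VarsIn : List ℕ → BoolComb s → Set
  VarsIn L (lt′ x y) = x ∈ L × y ∈ L
  VarsIn L (succ′ x y) = x ∈ L × y ∈ L
  VarsIn L (eq′ x y) = x ∈ L × y ∈ L
  VarsIn L (or′ b c) = VarsIn L b × VarsIn L c
  VarsIn L (neg′ b) = VarsIn L b
  VarsIn L (at′ χ x) = x ∈ L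

  rename : (ℕ → ℕ) → BoolComb s → BoolComb s
  rename r (lt′ x y) = lt′ (r x) (r y)
  rename r (succ′ x y) = succ′ (r x) (r y)
  rename r (eq′ x y) = eq′ (r x) (r y)
  rename r (or′ b c) = or′ (rename r b) (rename r c)
  rename r (neg′ b) = neg′ (rename r b)
  rename r (at′ χ x) = at′ χ (r x)

  rename-sat : ∀ (M : Model s) r b g → ⟦ rename r b ⟧ M g ⇔ ⟦ b ⟧ M (g ∘ r)
  rename-sat M r (lt′ x y) g = mk⇔ id id
  rename-sat M r (succ′ x y) g = mk⇔ id id
  rename-sat M r (eq′ x y) g = mk⇔ id id
  rename-sat M r (or′ b c) g = mk⇔
    (λ h (¬b , ¬c) → h (¬b ∘ to (rename-sat M r b g) , ¬c ∘ to (rename-sat M r c g)))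
    (λ h (¬b , ¬c) → h (¬b ∘ from (rename-sat M r b g) , ¬c ∘ from (rename-sat M r c g)))
  rename-sat M r (neg′ b) g = mk⇔ (λ ¬b → ¬b ∘ from (rename-sat M r b g)) (λ ¬b → ¬b ∘ to (rename-sat M r b g))
  rename-sat M r (at′ χ x) g = mk⇔ id id

  rename-vars : ∀ {L} r b → (∀ z → r z ∈ L) → VarsIn L (rename r b)
  rename-vars r (lt′ x y) r∈L = r∈L x , r∈L y
  rename-vars r (succ′ x y) r∈L = r∈L x , r∈L y
  rename-vars r (eq′ x y) r∈L = r∈L x , r∈L y
  rename-vars r (or′ b c) r∈L = rename-vars r b r∈L , rename-vars r c r∈L
  rename-vars r (neg′ b) r∈L = rename-vars r b r∈L
  rename-vars r (at′ χ x) r∈L = r∈L x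

  #at : BoolComb s → ℕ
  #at (or′ b c) = #at b + #at c
  #at (neg′ b) = #at b
  #at (at′ χ x) = 1
  #at _ = 0

  occurrence : (b : BoolComb s) → Fin (#at b) → Unary s × ℕ
  occurrence (or′ b c) i = [ occurrence b , occurrence c ]′ (splitAt (#at b) i)
  occurrence (neg′ b) i = occurrence b i
  occurrence (at′ χ x) zero = χ , x

  occurrence-vars : ∀ {L} b → VarsIn L b → ∀ i → proj₂ (occurrence b i) ∈ L
  occurrence-vars (or′ b c) (vb , vc) i with splitAt (#at b) i
  ... | inj₁ j = occurrence-vars b vb j
  ... | inj₂ j = occurrence-vars c vc j
  occurrence-vars (neg′ b) vb i = occurrence-vars b vb i
  occurrence-vars (at′ χ x) x∈L zero = x∈L

  eval : (b : BoolComb s) → (ℕ → ℕ) → (Fin (#at b) → Bool) → Bool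
  eval (lt′ x y) u β = isYes (u x <? u y)
  eval (succ′ x y) u β = isYes (suc (u x) ≟ u y)
  eval (eq′ x y) u β = isYes (u x ≟ u y)
  eval (or′ b c) u β = eval b u (β ∘ (_↑ˡ #at c)) ∨ eval c u (β ∘ (#at b ↑ʳ_))
  eval (neg′ b) u β = not (eval b u β)
  eval (at′ χ x) u β = β zero

  module _ (M : Model s) where

    Agrees : (ℕ → ℕ) → Unary s × ℕ → Bool → Set
    Agrees g (χ , x) bit = T bit ⇔ M ⊨ χ at g x

    Faithful : (b : BoolComb s) → (ℕ → ℕ) → (Fin (#at b) → Bool) → Set
    Faithful b g β = ∀ i → Agrees g (occurrence b i) (β i)

    eval-correct : ∀ {L g u} b {β} → VarsIn L b → SameType L g u → Faithful b g β → T (eval b u β) ⇔ ⟦ b ⟧ M g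
    eval-correct (lt′ x y) (x∈ , y∈) same _ = ⇔-trans (True⇔ _) (⇔-sym (proj₁ (same x∈ y∈)))
    eval-correct (succ′ x y) (x∈ , y∈) same _ = ⇔-trans (True⇔ _) (⇔-sym (proj₂ (same x∈ y∈)))
    eval-correct {g = g} {u} (eq′ x y) (x∈ , y∈) same _ = ⇔-trans (True⇔ (u x ≟ u y))
      (mk⇔ (SameType-≡ (SameType-sym same) x∈ y∈) (SameType-≡ same x∈ y∈))
    eval-correct {g = g} {u} (or′ b c) {β} (vb , vc) same faithful =
      T-∨ (eval b u (β ∘ (_↑ˡ #at c))) (eval c u (β ∘ (#at b ↑ʳ_)))
        (eval-correct b vb same (λ i → subst (λ o → Agrees g o (β (i ↑ˡ #at c)))
           (cong [ occurrence b , occurrence c ]′ (Fin.splitAt-↑ˡ (#at b) i (#at c))) (faithful (i ↑ˡ #at c))))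
        (eval-correct c vc same (λ i → subst (λ o → Agrees g o (β (#at b ↑ʳ i)))
           (cong [ occurrence b , occurrence c ]′ (Fin.splitAt-↑ʳ (#at b) (#at c) i)) (faithful (#at b ↑ʳ i))))
    eval-correct {u = u} (neg′ b) {β} vb same faithful = T-not (eval b u β) (eval-correct b vb same faithful)
    eval-correct (at′ χ x) _ _ faithful = faithful zero

¬¬-characteristic : ∀ n (P : Fin n → Set) → ¬ ¬ Σ (Vec Bool n) λ v → ∀ i → T (lookup v i) ⇔ P i
¬¬-characteristic zero P = return ([] , λ ())
¬¬-characteristic (suc n) P = do
  p? ← ¬¬-excluded-middle {A = P zero}
  (v , v✓) ← ¬¬-characteristic n (P ∘ suc)
  return (isYes p? ∷ v , λ { zero → True⇔ p? ; (suc i) → v✓ i })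

every-bool : ∀ {n} (v : Vec Bool n) → All (_∈ true ∷ false ∷ []) v
every-bool [] = []
every-bool (true ∷ v) = here refl ∷ every-bool v
every-bool (false ∷ v) = there (here refl) ∷ every-bool v

env : (L : List ℕ) → Vec ℕ (length L) → ℕ → ℕ
env [] [] = λ _ → 0
env (x ∷ L) (c ∷ cs) = env L cs [ x ↦ c ]

env-≤ : ∀ {m} L {cs} → All (_∈ upTo (suc m)) cs → ∀ z → env L cs z ≤ m
env-≤ [] [] z = z≤n
env-≤ (x ∷ L) (c∈ ∷ cs∈) z with z ≟ x
... | yes _ = ℕ.≤-pred (∈-upTo⁻ c∈)
... | no _ = env-≤ L cs∈ z

env-tabulate : ∀ u L {z} → z ∈ L → env L (Vec.map u (Vec.fromList L)) z ≡ u z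
env-tabulate u (x ∷ L) {z} z∈ with z ≟ x
... | yes refl = refl
... | no z≢x = env-tabulate u L (Any.tail z≢x z∈)

tabulate-bounded : ∀ {u : ℕ → ℕ} {m} L → (∀ z → u z ≤ m) → All (_∈ upTo (suc m)) (Vec.map u (Vec.fromList L))
tabulate-bounded [] u≤ = []
tabulate-bounded (x ∷ L) u≤ = ∈-upTo⁺ (s≤s (u≤ x)) ∷ tabulate-bounded L u≤

module _ {s : ℕ} where

  labels : (b : BoolComb s) → (ℕ → ℕ) → (Fin (#at b) → Bool) → ℕ → Unary s
  labels b u β t = ⋀ⁱ (#at b) λ i → when (u (proj₂ (occurrence b i)) ≟ t) (literal (proj₁ (occurrence b i)) (β i))

  labels-sat : ∀ (M : Model s) b u β t {p} →
               M ⊨ labels b u β t at p ⇔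
               (∀ i → u (proj₂ (occurrence b i)) ≡ t → T (β i) ⇔ M ⊨ proj₁ (occurrence b i) at p)
  labels-sat M b u β t = ⇔-trans (⋀ⁱ-sat M (#at b) _) (mk⇔
    (λ h i at-t → to (literal-sat M _ (β i)) (to (when-sat M (_ ≟ t) _) (h i) at-t))
    (λ h i → from (when-sat M (_ ≟ t) _) (from (literal-sat M _ (β i)) ∘ h i)))

module ExistentialClosure {s : ℕ} (x₀ : ℕ) (L : List ℕ) (x₀∈L : x₀ ∈ L) (b : BoolComb s) (vars : VarsIn L b) where

  Occupied : (ℕ → ℕ) → ℕ → Set
  Occupied u t = Any (λ x → u x ≡ t) L

  occupied? : ∀ u t → Dec (Occupied u t)
  occupied? u t = any? (λ x → u x ≟ t) L

  occupied : ∀ {u x} → x ∈ L → Occupied u (u x)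
  occupied {u} = Any.map (λ x≡y → cong u (sym x≡y))

  bound : ℕ
  bound = length L + length L

  module ChainOf (u : ℕ → ℕ) (β : Fin (#at b) → Bool) = Chain (Occupied u) (occupied? u) (labels b u β) bound (u x₀)

  -- u places the variables, β guesses the truth value of each unary occurrence; the chain checks both.
  candidate : (ℕ → ℕ) → (Fin (#at b) → Bool) → Unary s
  candidate u β = if eval b u β then ChainOf.chain u β else ⊥₁

  candidates : Vec ℕ (length L) → Unary s
  candidates cs = ⋁-vec (true ∷ false ∷ []) (#at b) (candidate (env L cs) ∘ lookup)

  closure : Unary s
  closure = ⋁-vec (upTo (suc bound)) (length L) candidates

  representative : (ℕ → ℕ) → (ℕ → ℕ) → ℕ → ℕ
  representative g u t with occupied? u t
  ... | yes o = g (proj₁ (find o))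
  ... | no _ = 0  -- never consulted: only occupied positions matter

  representative-spec : ∀ {g u x} → SameType L g u → x ∈ L → representative g u (u x) ≡ g x
  representative-spec {g} {u} {x} same x∈ with occupied? u (u x)
  ... | no ¬o = ⊥-elim (¬o (occupied x∈))
  ... | yes o = let (y , y∈ , uy≡ux) = find o in SameType-≡ (SameType-sym same) y∈ x∈ uy≡ux

  SameType⇒Embeds : ∀ {g u} → SameType L g u → Embeds (representative g u) (Occupied u)
  SameType⇒Embeds {g} {u} same o o′ with find o | find o′
  ... | x , x∈ , refl | y , y∈ , refl rewrite representative-spec same x∈ | representative-spec same y∈ =
    from (proj₁ (same x∈ y∈)) , ⇔-sym (proj₂ (same x∈ y∈))

  Embeds⇒SameType : ∀ {u w} → Embeds w (Occupied u) → SameType L (w ∘ u) u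
  Embeds⇒SameType {u} {w} emb {x} {y} x∈ y∈ =
    mk⇔ reflect (proj₁ (emb (occupied x∈) (occupied y∈))) , ⇔-sym (proj₂ (emb (occupied x∈) (occupied y∈)))
    where
    reflect : w (u x) < w (u y) → u x < u y
    reflect wx<wy with ℕ.<-cmp (u x) (u y)
    ... | tri< ux<uy _ _ = ux<uy
    ... | tri≈ _ ux≡uy _ = ⊥-elim (ℕ.<-irrefl (cong w ux≡uy) wx<wy)
    ... | tri> _ _ uy<ux = ⊥-elim (ℕ.<-asym wx<wy (proj₁ (emb (occupied y∈) (occupied x∈)) uy<ux))

  module _ (M : Model s) where

    Witness : ℕ → Set
    Witness a = Σ (ℕ → ℕ) λ g → (∀ {x} → x ∈ L → InDom M (g x)) × g x₀ ≡ a × ⟦ b ⟧ M g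

    Labelled : (ℕ → ℕ) → (Fin (#at b) → Bool) → (ℕ → ℕ) → Set
    Labelled u β w = Walk.Labelled (labels b u β) M w (Occupied u)

    Labelled⇒Faithful : ∀ {u β w} → Labelled u β w → Faithful M b (w ∘ u) β
    Labelled⇒Faithful {u} {β} lab i =
      to (labels-sat M b u β _) (proj₂ (lab (occupied (occurrence-vars b vars i)))) i refl

    SameType⇒Labelled : ∀ {g u β} → SameType L g u → (∀ {x} → x ∈ L → InDom M (g x)) → Faithful M b g β →
                        Labelled u β (representative g u)
    SameType⇒Labelled {g} {u} {β} same g∈M faithful o with find o
    ... | x , x∈ , refl rewrite representative-spec same x∈ =
      g∈M x∈ , from (labels-sat M b u β (u x)) (λ i uxᵢ≡ux →
        subst (λ v → T (β i) ⇔ M ⊨ proj₁ (occurrence b i) at v)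
          (SameType-≡ (SameType-sym same) (occurrence-vars b vars i) x∈ uxᵢ≡ux) (faithful i))

    candidate-sound : ∀ {u β a} → (∀ z → u z ≤ bound) → InDom M a → M ⊨ candidate u β at a → ¬ ¬ Witness a
    candidate-sound {u} {β} {a} u≤ a∈M h with eval b u β in eval≡
    ... | false = ⊥-elim (⊥₁-unsat M h)
    ... | true = do
      (w , wu₀≡a , lab , emb) ← ChainOf.chain-sound u β M occupied≤ a∈M h
      return (w ∘ u , (λ {x} x∈ → proj₁ (lab (occupied {x = x} x∈))) , wu₀≡a ,
              to (eval-correct M b vars (Embeds⇒SameType emb) (Labelled⇒Faithful lab)) (subst T (sym eval≡) tt))
      where
      occupied≤ : ∀ {t} → Occupied u t → t ≤ bound
      occupied≤ o = let (x , _ , ux≡t) = find o in subst (_≤ bound) ux≡t (u≤ x)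

    candidate-complete : ∀ {g u β} → SameType L g u → (∀ {x} → x ∈ L → InDom M (g x)) → Faithful M b g β →
                         ⟦ b ⟧ M g → M ⊨ candidate u β at g x₀
    candidate-complete {g} {u} {β} same g∈M faithful b✓ with eval b u β in eval≡
    ... | false = ⊥-elim (subst T eval≡ (from (eval-correct M b vars same faithful) b✓))
    ... | true = subst (M ⊨ ChainOf.chain u β at_) (representative-spec same x₀∈L)
      (ChainOf.chain-complete u β M (occupied x₀∈L) (SameType⇒Embeds same) (SameType⇒Labelled same g∈M faithful))

    closure-sound : ∀ {a} → InDom M a → M ⊨ closure at a → ¬ ¬ Witness a
    closure-sound a∈M h = do
      (cs , cs≤ , inner) ← to (⋁-vec-sat M (upTo (suc bound)) (length L) candidates) h
      (v , _ , cand) ← to (⋁-vec-sat M (true ∷ false ∷ []) (#at b) (candidate (env L cs) ∘ lookup)) inner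
      candidate-sound (env-≤ L cs≤) a∈M cand

    closure-complete : ∀ {a} → Witness a → M ⊨ closure at a
    closure-complete (g , g∈M , refl , b✓) = Sat-stable M _ (formula closure) (do
      (v , faithful) ← ¬¬-characteristic (#at b) (λ i → M ⊨ proj₁ (occurrence b i) at g (proj₂ (occurrence b i)))
      return (from (⋁-vec-sat M (upTo (suc bound)) (length L) candidates) (return (cs , tabulate-bounded L (rank-bound ∘ g) ,
        from (⋁-vec-sat M (true ∷ false ∷ []) (#at b) (candidate (env L cs) ∘ lookup)) (return (v , every-bool v ,
          candidate-complete (SameType-cong (env-tabulate compress L) compress-sameType) g∈M faithful b✓))))))
      where
      open Compression g L
      cs : Vec ℕ (length L)
      cs = Vec.map compress (Vec.fromList L)

-- From F₁ to FO²

module _ {s : ℕ} (M : Model s) where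

  exs-sat : ∀ xs φ ρ → Admissible M ρ →
            Sat M ρ (exs xs φ) ⇔ (¬ ¬ Σ (ℕ → ℕ) λ ρ′ → Admissible M ρ′ × (∀ z → z ∉ xs → ρ′ z ≡ ρ z) × Sat M ρ′ φ)
  exs-sat [] φ ρ ρ∈M = mk⇔
    (λ h → return (ρ , ρ∈M , (λ _ _ → refl) , h))
    (λ h → Sat-stable M ρ φ (do
      (ρ′ , _ , ρ′≗ρ , φ✓) ← h
      return (Sat-coincidence M φ (λ z _ → ρ′≗ρ z λ ()) φ✓)))
  exs-sat (x ∷ xs) φ ρ ρ∈M = mk⇔
    (λ h → do
      (i , i∈M , rest) ← to (ex-sat M x (exs xs φ)) h
      (ρ′ , ρ′∈M , ρ′≗ , φ✓) ← to (exs-sat xs φ (ρ [ x ↦ i ]) (admissible-upd M x ρ∈M i∈M)) rest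
      return (ρ′ , ρ′∈M , (λ z z∉ → trans (ρ′≗ z (λ z∈ → z∉ (there z∈))) (upd-other ρ i (λ z≡x → z∉ (here z≡x)))) , φ✓))
    (λ h → from (ex-sat M x (exs xs φ)) (do
      (ρ′ , ρ′∈M , ρ′≗ , φ✓) ← h
      return (ρ′ x , ρ′∈M x , from (exs-sat xs φ (ρ [ x ↦ ρ′ x ]) (admissible-upd M x ρ∈M (ρ′∈M x)))
        (return (ρ′ , ρ′∈M , agree ρ′≗ , φ✓)))))
    where
    agree : ∀ {ρ′ : ℕ → ℕ} → (∀ z → z ∉ x ∷ xs → ρ′ z ≡ ρ z) → ∀ z → z ∉ xs → ρ′ z ≡ (ρ [ x ↦ ρ′ x ]) z
    agree ρ′≗ z z∉ with z ≟ x
    ... | yes refl = refl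
    ... | no z≢x = ρ′≗ z λ { (here z≡x) → z≢x z≡x ; (there z∈) → z∉ z∈ }

module _ {s : ℕ} where

  ∃₁ : Unary s → Unary s
  ∃₁ χ = fo2 (ex 0 (formula χ)) (s≤s z≤n , isFO2 χ) (λ z (z≢0 , z∈χ) → ⊥-elim (z≢0 (free⊆ χ z z∈χ)))

  ∃₁-sat : ∀ (M : Model s) χ {p} → M ⊨ ∃₁ χ at p ⇔ (¬ ¬ Σ ℕ λ i → InDom M i × M ⊨ χ at i)
  ∃₁-sat M χ {p} = ⇔-trans (ex-sat M 0 (formula χ)) (mk⇔
    (λ h → do (i , i∈M , χ✓) ← h ; return (i , i∈M , to (unary-sat M _ χ) χ✓))
    (λ h → do (i , i∈M , χ✓) ← h ; return (i , i∈M , from (unary-sat M _ χ) χ✓)))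

  _≃_ : Formula s → BoolComb s → Set
  φ ≃ b = ∀ M ρ → Admissible M ρ → Sat M ρ φ ⇔ ⟦ b ⟧ M ρ

  _≃₁_at_ : Formula s → Unary s → ℕ → Set
  φ ≃₁ χ at x = ∀ M ρ → Admissible M ρ → Sat M ρ φ ⇔ M ⊨ χ at ρ x

  ex-≃ : ∀ x {φ χ} → φ ≃₁ χ at x → ex x φ ≃ at′ (∃₁ χ) x
  ex-≃ x {φ} {χ} φ≃χ M ρ ρ∈M = ⇔-trans (ex-sat M x φ) (⇔-trans
    (mk⇔ (λ h → do (i , i∈M , φ✓) ← h ; return (i , i∈M , to (moved i∈M) φ✓))
         (λ h → do (i , i∈M , χ✓) ← h ; return (i , i∈M , from (moved i∈M) χ✓)))
    (⇔-sym (∃₁-sat M χ)))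
    where
    moved : ∀ {i} → InDom M i → Sat M (ρ [ x ↦ i ]) φ ⇔ M ⊨ χ at i
    moved {i} i∈M = subst (λ v → Sat M (ρ [ x ↦ i ]) φ ⇔ M ⊨ χ at v) (upd-same ρ x i)
                          (φ≃χ M (ρ [ x ↦ i ]) (admissible-upd M x ρ∈M i∈M))

existential-closure : ∀ {s} (x₀ : ℕ) (xs : List ℕ) → x₀ ∉ xs → (φ : Formula s) (b : BoolComb s) →
  (∀ z → Free z φ → z ∈ x₀ ∷ xs) → φ ≃ b →
  Σ (Unary s) λ χ → exs xs φ ≃₁ χ at x₀
existential-closure {s} x₀ xs x₀∉xs φ b free⊆L φ≃b = closure , equivalence
  where
  L : List ℕ
  L = x₀ ∷ xs

  -- φ has no free variables outside L, so renaming them to x₀ is harmless.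
  into : ℕ → ℕ
  into z with z ∈? L
  ... | yes _ = z
  ... | no _ = x₀

  into-∈ : ∀ z → into z ∈ L
  into-∈ z with z ∈? L
  ... | yes z∈ = z∈
  ... | no _ = here refl

  into-id : ∀ {z} → z ∈ L → into z ≡ z
  into-id {z} z∈ with z ∈? L
  ... | yes _ = refl
  ... | no z∉ = ⊥-elim (z∉ z∈)

  open ExistentialClosure x₀ L (here refl) (rename into b) (rename-vars into b into-∈)

  φ⇔b : ∀ M g → (∀ {x} → x ∈ L → InDom M (g x)) → Sat M g φ ⇔ ⟦ rename into b ⟧ M g
  φ⇔b M g g∈M = ⇔-trans
    (mk⇔ (Sat-coincidence M φ (λ z z∈φ → cong g (sym (into-id (free⊆L z z∈φ)))))
         (Sat-coincidence M φ (λ z z∈φ → cong g (into-id (free⊆L z z∈φ)))))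
    (⇔-trans (φ≃b M (g ∘ into) (g∈M ∘ into-∈)) (⇔-sym (rename-sat M into b g)))

  extend : (ℕ → ℕ) → (ℕ → ℕ) → ℕ → ℕ
  extend g ρ z with z ∈? xs
  ... | yes _ = g z
  ... | no _ = ρ z

  extend-free : ∀ {g ρ} → g x₀ ≡ ρ x₀ → ∀ z → Free z φ → g z ≡ extend g ρ z
  extend-free {g} {ρ} gx₀≡ρx₀ z z∈φ with z ∈? xs | free⊆L z z∈φ
  ... | yes _ | _ = refl
  ... | no _ | here refl = gx₀≡ρx₀
  ... | no z∉ | there z∈ = ⊥-elim (z∉ z∈)

  extend-admissible : ∀ {M : Model s} {g ρ} → (∀ {x} → x ∈ L → InDom M (g x)) → Admissible M ρ →
                      Admissible M (extend g ρ)
  extend-admissible g∈M ρ∈M z with z ∈? xs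
  ... | yes z∈ = g∈M (there z∈)
  ... | no _ = ρ∈M z

  extend-outside : ∀ {g ρ} z → z ∉ xs → extend g ρ z ≡ ρ z
  extend-outside z z∉ with z ∈? xs
  ... | yes z∈ = ⊥-elim (z∉ z∈)
  ... | no _ = refl

  equivalence : exs xs φ ≃₁ closure at x₀
  equivalence M ρ ρ∈M = mk⇔
    (λ h → Sat-stable M (λ _ → ρ x₀) (formula closure) (do
      (ρ′ , ρ′∈M , ρ′≗ρ , φ✓) ← to (exs-sat M xs φ ρ ρ∈M) h
      return (closure-complete M (ρ′ , (λ {x} _ → ρ′∈M x) , ρ′≗ρ x₀ x₀∉xs , to (φ⇔b M ρ′ (λ {x} _ → ρ′∈M x)) φ✓))))
    (λ h → from (exs-sat M xs φ ρ ρ∈M) (do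
      (g , g∈M , gx₀≡ρx₀ , b✓) ← closure-sound M (ρ∈M x₀) h
      return (extend g ρ , extend-admissible {M = M} g∈M ρ∈M , extend-outside ,
              Sat-coincidence M φ (extend-free gx₀≡ρx₀) (from (φ⇔b M g g∈M) b✓))))

F1⇒BoolComb : ∀ {s} {φ : Formula s} → F1 φ → Σ (BoolComb s) (φ ≃_)
F1⇒BoolComb (f-rel P x) = at′ (fo2 (rel P 0) (s≤s z≤n) (λ _ z≡0 → z≡0)) x , λ _ _ _ → mk⇔ id id
F1⇒BoolComb (f-succ x y) = succ′ x y , λ _ _ _ → mk⇔ id id
F1⇒BoolComb (f-lt x y) = lt′ x y , λ _ _ _ → mk⇔ id id
F1⇒BoolComb (f-eq x y) = eq′ x y , λ _ _ _ → mk⇔ id id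
F1⇒BoolComb (f-or F1φ F1ψ) with F1⇒BoolComb F1φ | F1⇒BoolComb F1ψ
... | b , φ≃b | c , ψ≃c = or′ b c , λ M ρ ρ∈M → mk⇔
  (λ h (¬b , ¬c) → h (¬b ∘ to (φ≃b M ρ ρ∈M) , ¬c ∘ to (ψ≃c M ρ ρ∈M)))
  (λ h (¬φ , ¬ψ) → h (¬φ ∘ from (φ≃b M ρ ρ∈M) , ¬ψ ∘ from (ψ≃c M ρ ρ∈M)))
F1⇒BoolComb (f-neg F1φ) with F1⇒BoolComb F1φ
... | b , φ≃b = neg′ b , λ M ρ ρ∈M → mk⇔ (λ ¬φ → ¬φ ∘ from (φ≃b M ρ ρ∈M)) (λ ¬b → ¬b ∘ to (φ≃b M ρ ρ∈M))
F1⇒BoolComb (f-exAll {φ} x₀ xs (x₀∉ ∷ _) F1φ free⊆) with F1⇒BoolComb F1φ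
... | b , φ≃b = let (χ , φ≃χ) = existential-closure x₀ xs (λ x₀∈ → ListAll.lookup x₀∉ x₀∈ refl) φ b free⊆ φ≃b
                in at′ (∃₁ χ) x₀ , ex-≃ x₀ {exs xs φ} {χ} φ≃χ
F1⇒BoolComb (f-exButOne {φ} x₀ xs (x₀∉ ∷ _) F1φ free⊆) with F1⇒BoolComb F1φ
... | b , φ≃b = let (χ , φ≃χ) = existential-closure x₀ xs (λ x₀∈ → ListAll.lookup x₀∉ x₀∈ refl) φ b free⊆ φ≃b
                in at′ χ x₀ , φ≃χ

F1⇒FO2 : ∀ {s} y₀ (ψ : Formula s) → F1 ψ → (∀ z → Free z ψ → z ≡ y₀) → Σ (Unary s) λ χ → ψ ≃₁ χ at y₀
F1⇒FO2 y₀ ψ F1ψ free≡y₀ = existential-closure y₀ [] (λ ()) ψ (proj₁ (F1⇒BoolComb F1ψ))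
                            (λ z z∈ψ → here (free≡y₀ z z∈ψ)) (proj₂ (F1⇒BoolComb F1ψ))

lemma3p2 : ∀ {s : ℕ} (y₀ : ℕ) (ψ : Formula s) → F1 ψ →
    (∀ z → Free z ψ → z ≡ y₀) →
    Σ (Formula s) (λ ψ′ → FO2 ψ′ × (∀ z → Free z ψ′ → z ≡ 0) ×
      (∀ (M : Model s) (a : ℕ) → InDom M a →
        (Sat M (λ _ → a) ψ → Sat M (λ _ → a) ψ′) ×
        (Sat M (λ _ → a) ψ′ → Sat M (λ _ → a) ψ)))
lemma3p2 {s} y₀ ψ F1ψ free≡y₀ = formula χ , isFO2 χ , free⊆ χ , λ M a a∈M →
  to (ψ≃χ M (λ _ → a) (λ _ → a∈M)) , from (ψ≃χ M (λ _ → a) (λ _ → a∈M))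
  where
  χ : Unary s
  χ = proj₁ (F1⇒FO2 y₀ ψ F1ψ free≡y₀)
  ψ≃χ : ψ ≃₁ χ at y₀
  ψ≃χ = proj₂ (F1⇒FO2 y₀ ψ F1ψ free≡y₀)
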